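{- Let $n>2$. The number of maximal chains of $(\mathfrak{C}(n)_\bot,\sqsubseteq)$ from $\bot$ to $N\{N\}$ is $\frac{(n!)^2}{2^{n-1}}$, and this is also the number of maximal chains of greatest length in $\mathfrak{C}(n)$.
   Context: Let $N=\{1,\dots,n\}$. An embedded subset is a pair $(S,\pi)$ with $S\subseteq N$ nonempty and $\pi$ a partition of $N$ having $S$ as a block; $\mathfrak{C}(n)$ is the set of embedded subsets, ordered by $(S,\pi)\sqsubseteq(S',\pi')$ iff $S\subseteq S'$ and $\pi$ refines $\pi'$, and $\mathfrak{C}(n)_\bot=\mathfrak{C}(n)\cup\{\bot\}$ with $\bot$ an added least element. $N\{N\}=(N,\{N\})$ is the top element. -}

module Defs where

open import Data.Nat using (ℕ; _*_; _^_; _∸_; _≤_; _!)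
open import Data.Nat.DivMod using (_/_)

open import Data.Nat.Properties using (m^n≢0)
open import Data.Fin using (Fin)
open import Data.Fin.Subset using (Subset; Nonempty) renaming (_∈_ to _∈ₛ_; _⊆_ to _⊆ₛ_; ⊤ to Fullₛ)
open import Data.Vec using (Vec; lookup; replicate)
open import Data.List using (List; length)
open import Data.List.Relation.Unary.All using (All)
open import Data.List.Relation.Unary.AllPairs using (AllPairs)
open import Data.List.Relation.Unary.Unique.Propositional using (Unique)
open import Data.List.Membership.Propositional using (_∈_)
open import Data.Maybe using (Maybe; just; nothing)
open import Data.Product using (Σ; ∃; _×_)
open import Data.Sum using (_⊎_)
open import Data.Unit using (⊤)
open import Data.Empty using (⊥)
open import Function.Bundles using (_⇔_)
open import Relation.Binary.PropositionalEquality using (_≡_; _≢_)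

-- Generic notions for a (sub)poset given by a carrier A, a predicate
-- Valid singling out the elements of the poset, and its order _≤_.
-- A chain is represented canonically as the list of its elements in
-- strictly increasing order.

module ChainsOf {A : Set} (Valid : A → Set) (_≤_ : A → A → Set) where

  _<_ : A → A → Set
  x < y = x ≤ y × x ≢ y

  IsChain : List A → Set
  IsChain c = All Valid c × AllPairs _<_ c

  IsMaximalChain : List A → Set
  IsMaximalChain c =
    IsChain c × (∀ x → Valid x → All (λ y → x ≤ y ⊎ y ≤ x) c → x ∈ c)

  IsLongestMaximalChain : List A → Set
  IsLongestMaximalChain c =
    IsMaximalChain c × (∀ d → IsMaximalChain d → length d Data.Nat.≤ length c)

NumberOf : {A : Set} → (List A → Set) → ℕ → Set
NumberOf {A} P k =
  Σ (List (List A)) λ L → Unique L × (∀ c → (c ∈ L) ⇔ P c) × length L ≡ k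

-- Partitions of N = Fin n, represented canonically by the map sending
-- each i to the block of π containing i.  The blocks of π are the sets
-- lookup π i.

Partition-rep : ℕ → Set
Partition-rep n = Vec (Subset n) n

IsPartition : ∀ {n} → Partition-rep n → Set
IsPartition {n} π =
  (∀ (i : Fin n) → i ∈ₛ lookup π i) ×
  (∀ (i j : Fin n) → j ∈ₛ lookup π i → lookup π j ≡ lookup π i)

IsBlock : ∀ {n} → Subset n → Partition-rep n → Set
IsBlock {n} S π = ∃ λ (i : Fin n) → lookup π i ≡ S

Refines : ∀ {n} → Partition-rep n → Partition-rep n → Set
Refines {n} π π' = ∀ (i : Fin n) → ∃ λ (j : Fin n) → lookup π i ⊆ₛ lookup π' j

Emb : ℕ → Set
Emb n = Subset n × Partition-rep n

IsEmbedded : ∀ {n} → Emb n → Set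
IsEmbedded (S Data.Product., π) = Nonempty S × IsPartition π × IsBlock S π

_⊑_ : ∀ {n} → Emb n → Emb n → Set
(S Data.Product., π) ⊑ (S' Data.Product., π') = S ⊆ₛ S' × Refines π π'

topEmb : (n : ℕ) → Emb n
topEmb n = Fullₛ Data.Product., replicate n Fullₛ

-- C(n)_⊥ : nothing plays the role of the added least element ⊥
Valid⊥ : ∀ {n} → Maybe (Emb n) → Set
Valid⊥ nothing = ⊤
Valid⊥ (just e) = IsEmbedded e

_⊑⊥_ : ∀ {n} → Maybe (Emb n) → Maybe (Emb n) → Set
nothing ⊑⊥ _ = ⊤
just _ ⊑⊥ nothing = ⊥
just e ⊑⊥ just e' = e ⊑ e'

module C (n : ℕ) = ChainsOf {Emb n} IsEmbedded _⊑_
module C⊥ (n : ℕ) = ChainsOf {Maybe (Emb n)} Valid⊥ _⊑⊥_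

IsMaxChain⊥toTop : (n : ℕ) → List (Maybe (Emb n)) → Set
IsMaxChain⊥toTop n c =
  C⊥.IsMaximalChain n c × nothing ∈ c × just (topEmb n) ∈ c

formula : ℕ → ℕ
formula n = _/_ ((n !) * (n !)) (2 ^ (n ∸ 1)) {{m^n≢0 2 (n ∸ 1)}}

-- The upper covers of an embedded subset (S , π) are obtained by merging two distinct blocks of π
-- (S becomes the union when it is one of them), so if π has k blocks there are k C 2 covers, each
-- with k − 1 blocks. The minimal elements are the n atoms ({i} , singletons), the top N{N} has a
-- single block, and a maximal chain climbs from an atom to N{N} through covers. Hence every maximal
-- chain has n elements, there are n · ∏_{k=2}^{n} (k C 2) = (n!)² / 2ⁿ⁻¹ of them, and adjoining ⊥
-- turns them bijectively into the maximal chains of C(n)_⊥ from ⊥ to N{N}.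

module Submission where

open import Defs

open import Level using (0ℓ)
open import Function using (id; _∘_; case_of_)
open import Function.Bundles using (mk⇔)
open import Data.Empty using (⊥; ⊥-elim)
open import Data.Unit using (tt)
import Data.Bool as Bool
open import Data.Product using (∃; _×_; _,_; proj₁; proj₂)
open import Data.Product.Properties using (≡-dec)
open import Data.Sum using (_⊎_; inj₁; inj₂)
open import Data.Maybe as Maybe using (Maybe; just; nothing)
open import Data.Maybe.Properties as Maybe using (just-injective)
open import Data.Nat as ℕ using (ℕ; zero; suc; _+_; _*_; _^_; _!; _<_; z≤n; s≤s)
open import Data.Nat.Properties as ℕ using (<⇒≤; suc-injective; *-distribˡ-+; *-assoc; m^n≢0)
open import Data.Nat.DivMod using (_/_; m*n/n≡m)
open import Data.Nat.Combinatorics using (_C_; nC1≡n; nCk+nC[k+1]≡[n+1]C[k+1])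
open import Data.Nat.Tactic.RingSolver using (solve-∀)
open import Data.Fin as Fin using (Fin; zero; suc; _≤_)
open import Data.Fin.Properties using (≤-antisym; ≤-trans; ≤-reflexive; <-irrefl; <-asym; <-cmp; ¬∀⟶∃¬)
open import Data.Fin.Subset using (Subset; inside; outside; _∪_; ⁅_⁆)
  renaming (_∈_ to _∈ₛ_; _⊆_ to _⊆ₛ_; ⊤ to ⊤ₛ)
open import Data.Fin.Subset.Properties
  using (⊆-antisym; p⊆p∪q; q⊆p∪q; x∈p∪q⁻; _∈?_; ∈⊤; x∈⁅x⁆; x∈⁅y⁆⇒x≡y)
open import Data.Vec as Vec using (Vec; []; _∷_; lookup; tabulate; replicate; here; there)
import Data.Vec.Properties as Vec
open import Data.Vec.Relation.Binary.Pointwise.Extensional using (ext; Pointwise-≡⇒≡)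
open import Data.List using (List; []; _∷_; _++_; length; map; filter; concatMap; head; drop; allFin)
open import Data.List.Properties
  using (length-++; length-map; length-tabulate; ∷-injectiveʳ; map-injective; filter-all)
open import Data.List.Membership.Propositional using (_∈_; find; lose)
open import Data.List.Membership.Propositional.Properties
  using (∈-++⁺ˡ; ∈-++⁺ʳ; ∈-++⁻; ∈-map⁺; ∈-map⁻; ∈-concatMap⁺; ∈-concatMap⁻;
         ∈-filter⁺; ∈-filter⁻; ∈-allFin)
open import Data.List.Relation.Unary.Any using (here; there)
open import Data.List.Relation.Unary.All as All using (All; []; _∷_)
import Data.List.Relation.Unary.All.Properties as All
open import Data.List.Relation.Unary.AllPairs as AllPairs using (AllPairs; []; _∷_)
import Data.List.Relation.Unary.AllPairs.Properties as AllPairs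
open import Data.List.Relation.Unary.Unique.Propositional using (Unique)
import Data.List.Relation.Unary.Unique.Propositional.Properties as Unique
open import Relation.Nullary using (¬_; Dec; yes; no)
open import Relation.Nullary.Decidable using (_⊎-dec_; _→-dec_; decidable-stable)
open import Relation.Unary using (Pred; Decidable)
open import Relation.Binary.Definitions using (Irreflexive; Asymmetric; tri<; tri≈; tri>)
open import Relation.Binary.PropositionalEquality
  using (_≡_; _≢_; refl; sym; trans; cong; cong₂; subst; module ≡-Reasoning)
open ≡-Reasoning

module _ {A B : Set} (f : A → List B) where

  ∈-concatMap⁺′ : ∀ {xs x c} → x ∈ xs → c ∈ f x → c ∈ concatMap f xs
  ∈-concatMap⁺′ x∈ c∈ = ∈-concatMap⁺ f (lose x∈ c∈)

  ∈-concatMap⁻′ : ∀ xs {c} → c ∈ concatMap f xs → ∃ λ x → x ∈ xs × c ∈ f x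
  ∈-concatMap⁻′ xs c∈ = find (∈-concatMap⁻ f {xs} c∈)

  length-concatMap-const : ∀ xs k → (∀ {x} → x ∈ xs → length (f x) ≡ k) →
                           length (concatMap f xs) ≡ length xs * k
  length-concatMap-const []       k _ = refl
  length-concatMap-const (x ∷ xs) k h =
    trans (length-++ (f x))
          (cong₂ _+_ (h (here refl)) (length-concatMap-const xs k (λ y∈ → h (there y∈))))

  -- key recovers x from every element of f x, which makes the lists f x pairwise disjoint.
  concatMap-unique : (key : B → Maybe A) → ∀ {xs} → Unique xs →
                     (∀ {x} → x ∈ xs → Unique (f x)) →
                     (∀ {x c} → x ∈ xs → c ∈ f x → key c ≡ just x) →
                     Unique (concatMap f xs)
  concatMap-unique key {[]}     _          _ _ = []
  concatMap-unique key {x ∷ xs} (x∉ ∷ xs!) u k =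
    Unique.++⁺ (u (here refl)) (concatMap-unique key xs! (λ y∈ → u (there y∈)) (λ y∈ → k (there y∈)))
               disjoint
    where
    disjoint : ∀ {c} → ¬ (c ∈ f x × c ∈ concatMap f xs)
    disjoint (c∈fx , c∈rest) with ∈-concatMap⁻′ xs c∈rest
    ... | y , y∈ , c∈fy =
      All.lookup x∉ y∈ (just-injective (trans (sym (k (here refl) c∈fx)) (k (there y∈) c∈fy)))

module _ {A B : Set} (f : A → B) where

  map-unique : ∀ {xs} → Unique xs → (∀ {a b} → a ∈ xs → b ∈ xs → f a ≡ f b → a ≡ b) →
               Unique (map f xs)
  map-unique {[]}     _          _   = []
  map-unique {x ∷ xs} (x∉ ∷ xs!) inj =
    All.tabulate fx∉ ∷ map-unique xs! (λ a∈ b∈ → inj (there a∈) (there b∈))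
    where
    fx∉ : ∀ {z} → z ∈ map f xs → f x ≢ z
    fx∉ z∈ fx≡z with ∈-map⁻ f z∈
    ... | a , a∈ , refl = All.lookup x∉ a∈ (inj (here refl) (there a∈) fx≡z)

module _ {A : Set} {P Q : Pred A 0ℓ} (P? : Decidable P) (Q? : Decidable Q) where

  length-filter-cong : ∀ xs → (∀ {z} → z ∈ xs → (P z → Q z) × (Q z → P z)) →
                       length (filter P? xs) ≡ length (filter Q? xs)
  length-filter-cong []       _ = refl
  length-filter-cong (x ∷ xs) h with P? x | Q? x
  ... | yes _  | yes _  = cong suc (length-filter-cong xs (λ z∈ → h (there z∈)))
  ... | no _   | no _   = length-filter-cong xs (λ z∈ → h (there z∈))
  ... | yes px | no ¬qx = ⊥-elim (¬qx (proj₁ (h (here refl)) px))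
  ... | no ¬px | yes qx = ⊥-elim (¬px (proj₂ (h (here refl)) qx))

  length-filter-remove : ∀ xs → Unique xs → ∀ {y} → y ∈ xs → P y →
                         (∀ {z} → Q z → P z × z ≢ y) → (∀ {z} → P z → z ≢ y → Q z) →
                         length (filter P? xs) ≡ suc (length (filter Q? xs))
  length-filter-remove (x ∷ xs) (x∉ ∷ xs!) (here refl) py q⇒p p⇒q with P? x | Q? x
  ... | no ¬py | _     = ⊥-elim (¬py py)
  ... | yes _  | yes q = ⊥-elim (proj₂ (q⇒p q) refl)
  ... | yes _  | no _  = cong suc (length-filter-cong xs λ z∈ →
    (λ pz → p⇒q pz (λ z≡x → All.lookup x∉ z∈ (sym z≡x))) , (λ qz → proj₁ (q⇒p qz)))
  length-filter-remove (x ∷ xs) (x∉ ∷ xs!) (there y∈) py q⇒p p⇒q with P? x | Q? x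
  ... | yes _  | yes _  = cong suc (length-filter-remove xs xs! y∈ py q⇒p p⇒q)
  ... | no _   | no _   = length-filter-remove xs xs! y∈ py q⇒p p⇒q
  ... | yes px | no ¬qx = ⊥-elim (¬qx (p⇒q px (λ { refl → All.lookup x∉ y∈ refl })))
  ... | no ¬px | yes qx = ⊥-elim (¬px (proj₁ (q⇒p qx)))

suc-C2 : ∀ m → suc m C 2 ≡ m + m C 2
suc-C2 m = trans (sym (nCk+nC[k+1]≡[n+1]C[k+1] m 1)) (cong (_+ m C 2) (nC1≡n m))

2*suc-C2 : ∀ m → 2 * (suc m C 2) ≡ suc m * m
2*suc-C2 zero    = refl
2*suc-C2 (suc m) = begin
  2 * (suc (suc m) C 2)           ≡⟨ cong (2 *_) (suc-C2 (suc m)) ⟩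
  2 * (suc m + suc m C 2)         ≡⟨ *-distribˡ-+ 2 (suc m) (suc m C 2) ⟩
  2 * suc m + 2 * (suc m C 2)     ≡⟨ cong (2 * suc m +_) (2*suc-C2 m) ⟩
  2 * suc m + suc m * m           ≡⟨ ring m ⟩
  suc (suc m) * suc m             ∎
  where
  ring : ∀ m → 2 * suc m + suc m * m ≡ suc (suc m) * suc m
  ring = solve-∀

pairsOf : {A : Set} → List A → List (A × A)
pairsOf []       = []
pairsOf (x ∷ xs) = map (x ,_) xs ++ pairsOf xs

length-pairsOf : {A : Set} (xs : List A) → length (pairsOf xs) ≡ length xs C 2
length-pairsOf []       = refl
length-pairsOf (x ∷ xs) = begin
  length (map (x ,_) xs ++ pairsOf xs)          ≡⟨ length-++ (map (x ,_) xs) ⟩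
  length (map (x ,_) xs) + length (pairsOf xs)  ≡⟨ cong₂ _+_ (length-map (x ,_) xs) (length-pairsOf xs) ⟩
  length xs + length xs C 2                     ≡⟨ sym (suc-C2 (length xs)) ⟩
  suc (length xs) C 2                           ∎

module _ {A : Set} {_≺_ : A → A → Set} where

  ∈-pairsOf⁻ : ∀ {xs} → AllPairs _≺_ xs → ∀ {a b} → (a , b) ∈ pairsOf xs →
               a ∈ xs × b ∈ xs × a ≺ b
  ∈-pairsOf⁻ {x ∷ xs} (x< ∷ xs<) ab∈ with ∈-++⁻ (map (x ,_) xs) ab∈
  ... | inj₂ ab∈′ = let a∈ , b∈ , a<b = ∈-pairsOf⁻ xs< ab∈′ in there a∈ , there b∈ , a<b
  ... | inj₁ ab∈′ with ∈-map⁻ (x ,_) ab∈′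
  ...   | b , b∈ , refl = here refl , there b∈ , All.lookup x< b∈

  ∈-pairsOf⁺ : Irreflexive _≡_ _≺_ → Asymmetric _≺_ → ∀ {xs} → AllPairs _≺_ xs →
               ∀ {a b} → a ∈ xs → b ∈ xs → a ≺ b → (a , b) ∈ pairsOf xs
  ∈-pairsOf⁺ irr asym {x ∷ xs} (x< ∷ _)   (here refl) (here refl) a≺b = ⊥-elim (irr refl a≺b)
  ∈-pairsOf⁺ irr asym {x ∷ xs} (x< ∷ _)   (here refl) (there b∈)  a≺b = ∈-++⁺ˡ (∈-map⁺ (x ,_) b∈)
  ∈-pairsOf⁺ irr asym {x ∷ xs} (x< ∷ _)   (there a∈)  (here refl) a≺b = ⊥-elim (asym a≺b (All.lookup x< a∈))
  ∈-pairsOf⁺ irr asym {x ∷ xs} (_ ∷ xs<) (there a∈)  (there b∈)  a≺b =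
    ∈-++⁺ʳ (map (x ,_) xs) (∈-pairsOf⁺ irr asym xs< a∈ b∈ a≺b)

  pairsOf-unique : Irreflexive _≡_ _≺_ → ∀ {xs} → AllPairs _≺_ xs → Unique (pairsOf xs)
  pairsOf-unique irr {[]}     []          = []
  pairsOf-unique irr {x ∷ xs} (x< ∷ xs<) =
    Unique.++⁺ (Unique.map⁺ (cong proj₂) xs!) (pairsOf-unique irr xs<) disjoint
    where
    xs! : Unique xs
    xs! = AllPairs.map (λ a<b a≡b → irr a≡b a<b) xs<
    disjoint : ∀ {p} → ¬ (p ∈ map (x ,_) xs × p ∈ pairsOf xs)
    disjoint (p∈₁ , p∈₂) with ∈-map⁻ (x ,_) p∈₁
    ... | b , b∈ , refl = let x∈ , _ = ∈-pairsOf⁻ xs< p∈₂ in irr refl (All.lookup x< x∈)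

-- Partitions and embedded subsets

minOf : ∀ {n} → Subset n → Maybe (Fin n)
minOf []            = nothing
minOf (inside ∷ p)  = just zero
minOf (outside ∷ p) = Maybe.map suc (minOf p)

minOf-∈ : ∀ {n} (p : Subset n) {m} → minOf p ≡ just m → m ∈ₛ p
minOf-∈ (inside ∷ p)  refl = here
minOf-∈ (outside ∷ p) eq with minOf p in e
minOf-∈ (outside ∷ p) refl | just m = there (minOf-∈ p e)

minOf-≤ : ∀ {n} (p : Subset n) {m x} → minOf p ≡ just m → x ∈ₛ p → m ≤ x
minOf-≤ (inside ∷ p)  refl _ = z≤n
minOf-≤ (outside ∷ p) eq (there x∈) with minOf p in e
minOf-≤ (outside ∷ p) refl (there x∈) | just m = s≤s (minOf-≤ p e x∈)

minOf-nonempty : ∀ {n} (p : Subset n) {x} → x ∈ₛ p → ∃ λ m → minOf p ≡ just m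
minOf-nonempty (inside ∷ p)  _          = zero , refl
minOf-nonempty (outside ∷ p) (there x∈) with minOf p | minOf-nonempty p x∈
... | just m | _ , refl = suc m , refl

minOf-unique : ∀ {n} (p : Subset n) {m} → m ∈ₛ p → (∀ {x} → x ∈ₛ p → m ≤ x) → minOf p ≡ just m
minOf-unique p m∈ m≤ with minOf-nonempty p m∈
... | m′ , e = trans e (cong just (≤-antisym (minOf-≤ p e m∈) (m≤ (minOf-∈ p e))))

module PartitionProperties {n : ℕ} {π : Partition-rep n} (P : IsPartition π) where

  ∈-own-block : ∀ i → i ∈ₛ lookup π i
  ∈-own-block = proj₁ P

  block-of-member : ∀ {i j} → j ∈ₛ lookup π i → lookup π j ≡ lookup π i
  block-of-member {i} {j} = proj₂ P i j

  blocks-meet : ∀ {i j k} → k ∈ₛ lookup π i → k ∈ₛ lookup π j → lookup π i ≡ lookup π j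
  blocks-meet k∈i k∈j = trans (sym (block-of-member k∈i)) (block-of-member k∈j)

  block-of-IsBlock : ∀ {T} → IsBlock T π → ∀ {x} → x ∈ₛ T → lookup π x ≡ T
  block-of-IsBlock (t , refl) = block-of-member

  embedded-≡ : ∀ {T T′} → IsBlock T π → IsBlock T′ π → ∀ {x} → x ∈ₛ T → x ∈ₛ T′ →
               (T , π) ≡ (T′ , π)
  embedded-≡ bT bT′ x∈T x∈T′ =
    cong (_, π) (trans (sym (block-of-IsBlock bT x∈T)) (block-of-IsBlock bT′ x∈T′))

Refines⇒⊆ : ∀ {n} {π π′ : Partition-rep n} → IsPartition π → IsPartition π′ → Refines π π′ →
            ∀ i → lookup π i ⊆ₛ lookup π′ i
Refines⇒⊆ {π = π} {π′} P P′ π≤π′ i {z} z∈ with π≤π′ i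
... | j , πi⊆π′j =
  subst (z ∈ₛ_) (sym (π′.block-of-member (πi⊆π′j (π.∈-own-block i)))) (πi⊆π′j z∈)
  where module π = PartitionProperties {π = π} P
        module π′ = PartitionProperties {π = π′} P′

module _ {n : ℕ} where

  ⊑-trans : {e e′ e″ : Emb n} → e ⊑ e′ → e′ ⊑ e″ → e ⊑ e″
  ⊑-trans {e = _ , _} {e′ = _ , _} {e″ = _ , _} (S⊆ , π≤) (S′⊆ , π′≤) =
    (λ z∈ → S′⊆ (S⊆ z∈)) ,
    λ i → let j , πi⊆ = π≤ i ; k , π′j⊆ = π′≤ j in k , λ z∈ → π′j⊆ (πi⊆ z∈)

  ⊑-antisym : {e e′ : Emb n} → IsEmbedded e → IsEmbedded e′ → e ⊑ e′ → e′ ⊑ e → e ≡ e′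
  ⊑-antisym {e = _ , π} {e′ = _ , π′} (_ , P , _) (_ , P′ , _) (S⊆ , π≤) (S′⊆ , π′≤) =
    cong₂ _,_ (⊆-antisym S⊆ S′⊆) (Pointwise-≡⇒≡ (ext λ i →
      ⊆-antisym (Refines⇒⊆ {π = π} {π′} P P′ π≤ i) (Refines⇒⊆ {π = π′} {π} P′ P π′≤ i)))

  block-⊆ : {S S′ : Subset n} {π π′ : Partition-rep n} →
            IsPartition π → IsPartition π′ → Refines π π′ →
            IsBlock S π → IsBlock S′ π′ → ∀ {x} → x ∈ₛ S → x ∈ₛ S′ → S ⊆ₛ S′
  block-⊆ {π = π} {π′} P P′ π≤π′ bS bS′ {x} x∈S x∈S′ {z} z∈ =
    subst (z ∈ₛ_) (π′.block-of-IsBlock bS′ x∈S′)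
      (Refines⇒⊆ {π = π} {π′} P P′ π≤π′ x (subst (z ∈ₛ_) (sym (π.block-of-IsBlock bS x∈S)) z∈))
    where module π = PartitionProperties {π = π} P
          module π′ = PartitionProperties {π = π′} P′

  record _⋖_ (e m : Emb n) : Set where
    field
      embedded : IsEmbedded m
      below    : e ⊑ m
      distinct : e ≢ m
      tight    : ∀ {t} → IsEmbedded t → e ⊑ t → t ⊑ m → t ≡ e ⊎ t ≡ m

-- Merging two blocks

module _ {n : ℕ} where

  _≟ₛ_ : (p q : Subset n) → Dec (p ≡ q)
  _≟ₛ_ = Vec.≡-dec Bool._≟_

  _≟ₑ_ : (e e′ : Emb n) → Dec (e ≡ e′)
  _≟ₑ_ = ≡-dec _≟ₛ_ (Vec.≡-dec _≟ₛ_)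

  OneOf : Subset n → Subset n → Subset n → Set
  OneOf A B C = C ≡ A ⊎ C ≡ B

  oneOf⇒⊆∪ : ∀ {A B C} → OneOf A B C → C ⊆ₛ A ∪ B
  oneOf⇒⊆∪ {A} {B} (inj₁ refl) = p⊆p∪q B
  oneOf⇒⊆∪ {A} {B} (inj₂ refl) = q⊆p∪q A B

  fuse : Subset n → Subset n → Subset n → Subset n
  fuse A B C with C ≟ₛ A ⊎-dec C ≟ₛ B
  ... | yes _ = A ∪ B
  ... | no _  = C

  fuse-cases : ∀ A B C → OneOf A B C × fuse A B C ≡ A ∪ B ⊎ ¬ OneOf A B C × fuse A B C ≡ C
  fuse-cases A B C with C ≟ₛ A ⊎-dec C ≟ₛ B
  ... | yes h = inj₁ (h , refl)
  ... | no ¬h = inj₂ (¬h , refl)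

  fuse-oneOf : ∀ {A B C} → OneOf A B C → fuse A B C ≡ A ∪ B
  fuse-oneOf {A} {B} {C} h with fuse-cases A B C
  ... | inj₁ (_ , eq)  = eq
  ... | inj₂ (¬h , _)  = ⊥-elim (¬h h)

  fuse-other : ∀ {A B C} → ¬ OneOf A B C → fuse A B C ≡ C
  fuse-other {A} {B} {C} ¬h with fuse-cases A B C
  ... | inj₁ (h , _)  = ⊥-elim (¬h h)
  ... | inj₂ (_ , eq) = eq

  ⊆-fuse : ∀ A B C → C ⊆ₛ fuse A B C
  ⊆-fuse A B C with fuse-cases A B C
  ... | inj₁ (h , eq) = λ z∈ → subst (_ ∈ₛ_) (sym eq) (oneOf⇒⊆∪ h z∈)
  ... | inj₂ (_ , eq) = λ z∈ → subst (_ ∈ₛ_) (sym eq) z∈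

  merge : Emb n → Fin n → Fin n → Emb n
  merge (S , π) x y = fuse A B S , Vec.map (fuse A B) π
    where A = lookup π x
          B = lookup π y

  module Merge {S : Subset n} {π : Partition-rep n} (E : IsEmbedded (S , π)) (x y : Fin n) where

    A = lookup π x
    B = lookup π y
    f = fuse A B
    P = proj₁ (proj₂ E)
    πm = Vec.map f π
    open PartitionProperties {π = π} P

    lookup-merge : ∀ i → lookup πm i ≡ f (lookup π i)
    lookup-merge i = Vec.lookup-map i f π

    ∈A∪B⇒oneOf : ∀ {j} → j ∈ₛ A ∪ B → OneOf A B (lookup π j)
    ∈A∪B⇒oneOf j∈ with x∈p∪q⁻ A B j∈
    ... | inj₁ j∈A = inj₁ (block-of-member j∈A)
    ... | inj₂ j∈B = inj₂ (block-of-member j∈B)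

    merge-isPartition : IsPartition πm
    merge-isPartition = own , same
      where
      own : ∀ i → i ∈ₛ lookup πm i
      own i = subst (i ∈ₛ_) (sym (lookup-merge i)) (⊆-fuse A B _ (∈-own-block i))
      same : ∀ i j → j ∈ₛ lookup πm i → lookup πm j ≡ lookup πm i
      same i j j∈ with fuse-cases A B (lookup π i)
      ... | inj₁ (_ , eq) = begin
        lookup πm j     ≡⟨ lookup-merge j ⟩
        f (lookup π j)  ≡⟨ fuse-oneOf (∈A∪B⇒oneOf (subst (j ∈ₛ_) (trans (lookup-merge i) eq) j∈)) ⟩
        A ∪ B           ≡⟨ sym (trans (lookup-merge i) eq) ⟩
        lookup πm i     ∎
      ... | inj₂ (_ , eq) = begin
        lookup πm j     ≡⟨ lookup-merge j ⟩
        f (lookup π j)  ≡⟨ cong f (block-of-member (subst (j ∈ₛ_) (trans (lookup-merge i) eq) j∈)) ⟩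
        f (lookup π i)  ≡⟨ sym (lookup-merge i) ⟩
        lookup πm i     ∎

    merge-embedded : IsEmbedded (merge (S , π) x y)
    merge-embedded =
      (s , ⊆-fuse A B S s∈) , merge-isPartition , (t , trans (lookup-merge t) (cong f πt≡S))
      where
      s = proj₁ (proj₁ E)
      s∈ = proj₂ (proj₁ E)
      t = proj₁ (proj₂ (proj₂ E))
      πt≡S = proj₂ (proj₂ (proj₂ E))

    ⊑-merge : (S , π) ⊑ merge (S , π) x y
    ⊑-merge = ⊆-fuse A B S , λ i → i , λ z∈ → subst (_ ∈ₛ_) (sym (lookup-merge i)) (⊆-fuse A B _ z∈)

    merge-≢ : A ≢ B → (S , π) ≢ merge (S , π) x y
    merge-≢ A≢B e≡m = A≢B (sym (block-of-member y∈A))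
      where
      A≡A∪B : A ≡ A ∪ B
      A≡A∪B = begin
        A             ≡⟨ cong (λ σ → lookup σ x) (cong proj₂ e≡m) ⟩
        lookup πm x   ≡⟨ lookup-merge x ⟩
        f A           ≡⟨ fuse-oneOf (inj₁ refl) ⟩
        A ∪ B         ∎
      y∈A : y ∈ₛ A
      y∈A = subst (y ∈ₛ_) (sym A≡A∪B) (q⊆p∪q A B (∈-own-block y))

    merge-least : ∀ {S′ π′} → IsEmbedded (S′ , π′) → (S , π) ⊑ (S′ , π′) →
                  lookup π′ x ≡ lookup π′ y → merge (S , π) x y ⊑ (S′ , π′)
    merge-least {S′} {π′} (_ , P′ , bS′) (S⊆S′ , π≤π′) π′x≡π′y = fS⊆S′ , πm≤π′
      where
      π⊆π′ : ∀ i → lookup π i ⊆ₛ lookup π′ i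
      π⊆π′ = Refines⇒⊆ {π = π} {π′} P P′ π≤π′
      A∪B⊆π′x : A ∪ B ⊆ₛ lookup π′ x
      A∪B⊆π′x z∈ with x∈p∪q⁻ A B z∈
      ... | inj₁ z∈A = π⊆π′ x z∈A
      ... | inj₂ z∈B = subst (_ ∈ₛ_) (sym π′x≡π′y) (π⊆π′ y z∈B)
      πm≤π′ : Refines πm π′
      πm≤π′ i with fuse-cases A B (lookup π i)
      ... | inj₁ (_ , eq) = x , λ z∈ → A∪B⊆π′x (subst (_ ∈ₛ_) (trans (lookup-merge i) eq) z∈)
      ... | inj₂ (_ , eq) = i , λ z∈ → π⊆π′ i (subst (_ ∈ₛ_) (trans (lookup-merge i) eq) z∈)
      fS⊆S′ : f S ⊆ₛ S′
      fS⊆S′ = let s , s∈ = proj₁ E in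
        block-⊆ {π = πm} {π′} merge-isPartition P′ πm≤π′ (proj₂ (proj₂ merge-embedded)) bS′
                (⊆-fuse A B S s∈) (S⊆S′ s∈)

    -- Every t with (S , π) ⊑ t ⊑ merge has, pointwise, a block between π i and f (π i);
    -- whether y joins the block of x in t decides which end t is.
    module Between {T ρ} (Et : IsEmbedded (T , ρ))
                   (e⊑t : (S , π) ⊑ (T , ρ)) (t⊑m : (T , ρ) ⊑ merge (S , π) x y) where

      private
        R = proj₁ (proj₂ Et)
        module ρ = PartitionProperties {π = ρ} R

      π⊆ρ : ∀ i → lookup π i ⊆ₛ lookup ρ i
      π⊆ρ = Refines⇒⊆ {π = π} {ρ} P R (proj₂ e⊑t)

      ρ⊆f : ∀ i → lookup ρ i ⊆ₛ f (lookup π i)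
      ρ⊆f i z∈ =
        subst (_ ∈ₛ_) (lookup-merge i) (Refines⇒⊆ {π = ρ} {πm} R merge-isPartition (proj₂ t⊑m) i z∈)

      ρ-fixed : ∀ {i} → ¬ OneOf A B (lookup π i) → lookup ρ i ≡ lookup π i
      ρ-fixed {i} ¬h = ⊆-antisym (λ z∈ → subst (_ ∈ₛ_) (fuse-other ¬h) (ρ⊆f i z∈)) (π⊆ρ i)

      ρ-in-A∪B : ∀ {i} → OneOf A B (lookup π i) → lookup ρ i ⊆ₛ A ∪ B
      ρ-in-A∪B {i} h z∈ = subst (_ ∈ₛ_) (fuse-oneOf h) (ρ⊆f i z∈)

      same-partition⇒≡ : ∀ {σ S′} → ρ ≡ σ → IsBlock S′ σ → S ⊆ₛ S′ → (T , ρ) ≡ (S′ , σ)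
      same-partition⇒≡ refl bS′ S⊆S′ = let s , s∈ = proj₁ E in
        ρ.embedded-≡ (proj₂ (proj₂ Et)) bS′ (proj₁ e⊑t s∈) (S⊆S′ s∈)

      joined : y ∈ₛ lookup ρ x → (T , ρ) ≡ merge (S , π) x y
      joined y∈ρx =
        same-partition⇒≡ (Pointwise-≡⇒≡ (ext ρ≡πm)) (proj₂ (proj₂ merge-embedded)) (⊆-fuse A B S)
        where
        A∪B⊆ρx : A ∪ B ⊆ₛ lookup ρ x
        A∪B⊆ρx z∈ with x∈p∪q⁻ A B z∈
        ... | inj₁ z∈A = π⊆ρ x z∈A
        ... | inj₂ z∈B = subst (_ ∈ₛ_) (ρ.block-of-member y∈ρx) (π⊆ρ y z∈B)
        ρ≡πm : ∀ i → lookup ρ i ≡ lookup πm i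
        ρ≡πm i with fuse-cases A B (lookup π i)
        ... | inj₂ (¬h , eq) = trans (ρ-fixed ¬h) (sym (trans (lookup-merge i) eq))
        ... | inj₁ (h , eq) = trans (⊆-antisym (ρ-in-A∪B h) A∪B⊆ρi) (sym (trans (lookup-merge i) eq))
          where
          A∪B⊆ρi : A ∪ B ⊆ₛ lookup ρ i
          A∪B⊆ρi z∈ =
            subst (_ ∈ₛ_) (sym (ρ.block-of-member (A∪B⊆ρx (oneOf⇒⊆∪ h (∈-own-block i))))) (A∪B⊆ρx z∈)

      separate : ¬ y ∈ₛ lookup ρ x → (T , ρ) ≡ (S , π)
      separate y∉ρx = same-partition⇒≡ (Pointwise-≡⇒≡ (ext ρ≡π)) (proj₂ (proj₂ E)) (λ z∈ → z∈)
        where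
        ρx⊆A : lookup ρ x ⊆ₛ A
        ρx⊆A {z} z∈ with x∈p∪q⁻ A B (ρ-in-A∪B (inj₁ refl) z∈)
        ... | inj₁ z∈A = z∈A
        ... | inj₂ z∈B = ⊥-elim (y∉ρx (subst (y ∈ₛ_) (ρ.blocks-meet (π⊆ρ y z∈B) z∈) (ρ.∈-own-block y)))
        ρy⊆B : lookup ρ y ⊆ₛ B
        ρy⊆B {z} z∈ with x∈p∪q⁻ A B (ρ-in-A∪B (inj₂ refl) z∈)
        ... | inj₂ z∈B = z∈B
        ... | inj₁ z∈A = ⊥-elim (y∉ρx (subst (y ∈ₛ_) (ρ.blocks-meet z∈ (π⊆ρ x z∈A)) (ρ.∈-own-block y)))
        ρ≡π : ∀ i → lookup ρ i ≡ lookup π i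
        ρ≡π i with fuse-cases A B (lookup π i)
        ... | inj₂ (¬h , _) = ρ-fixed ¬h
        ... | inj₁ (inj₁ πi≡A , _) =
          ⊆-antisym (λ z∈ → subst (_ ∈ₛ_) (sym πi≡A) (ρx⊆A (subst (_ ∈ₛ_) ρi≡ρx z∈))) (π⊆ρ i)
          where ρi≡ρx = ρ.block-of-member (π⊆ρ x (subst (i ∈ₛ_) πi≡A (∈-own-block i)))
        ... | inj₁ (inj₂ πi≡B , _) =
          ⊆-antisym (λ z∈ → subst (_ ∈ₛ_) (sym πi≡B) (ρy⊆B (subst (_ ∈ₛ_) ρi≡ρy z∈))) (π⊆ρ i)
          where ρi≡ρy = ρ.block-of-member (π⊆ρ y (subst (i ∈ₛ_) πi≡B (∈-own-block i)))

    merge-⋖ : A ≢ B → (S , π) ⋖ merge (S , π) x y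
    merge-⋖ A≢B = record
      { embedded = merge-embedded
      ; below    = ⊑-merge
      ; distinct = merge-≢ A≢B
      ; tight    = λ {t} → tight t
      }
      where
      tight : ∀ t → IsEmbedded t → (S , π) ⊑ t → t ⊑ merge (S , π) x y →
              t ≡ (S , π) ⊎ t ≡ merge (S , π) x y
      tight (T , ρ) Et e⊑t t⊑m with y ∈? lookup ρ x
      ... | yes y∈ρx = inj₂ (Between.joined Et e⊑t t⊑m y∈ρx)
      ... | no y∉ρx  = inj₁ (Between.separate Et e⊑t t⊑m y∉ρx)

-- Covers

module _ {n : ℕ} where

  -- Blocks are indexed by their least elements, so the covers of (S , π) are listed by the
  -- pairs a < b of representatives.
  IsRep : Partition-rep n → Fin n → Set
  IsRep π i = minOf (lookup π i) ≡ just i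

  isRep? : (π : Partition-rep n) → Decidable (IsRep π)
  isRep? π i = Maybe.≡-dec Fin._≟_ (minOf (lookup π i)) (just i)

  reps : Partition-rep n → List (Fin n)
  reps π = filter (isRep? π) (allFin n)

  #blocks : Emb n → ℕ
  #blocks (_ , π) = length (reps π)

  reps-sorted : (π : Partition-rep n) → AllPairs Fin._<_ (reps π)
  reps-sorted π = AllPairs.filter⁺ (isRep? π) (AllPairs.tabulate⁺-< id)

  ∈-reps⁺ : ∀ π {i} → IsRep π i → i ∈ reps π
  ∈-reps⁺ π {i} = ∈-filter⁺ (isRep? π) (∈-allFin i)

  ∈-reps⁻ : ∀ π {i} → i ∈ reps π → IsRep π i
  ∈-reps⁻ π i∈ = proj₂ (∈-filter⁻ (isRep? π) {xs = allFin n} i∈)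

  rep-injective : ∀ π {a b} → IsRep π a → IsRep π b → lookup π a ≡ lookup π b → a ≡ b
  rep-injective π ra rb πa≡πb = just-injective (trans (sym ra) (trans (cong minOf πa≡πb) rb))

  rep-of : ∀ {π} → IsPartition π → ∀ i → ∃ λ r → IsRep π r × lookup π r ≡ lookup π i
  rep-of {π} P i with minOf-nonempty (lookup π i) (proj₁ P i)
  ... | r , min≡r = r , trans (cong minOf πr≡πi) min≡r , πr≡πi
    where πr≡πi = proj₂ P i r (minOf-∈ (lookup π i) min≡r)

  covers : Emb n → List (Emb n)
  covers e = map (λ (a , b) → merge e a b) (pairsOf (reps (proj₂ e)))

  ∈-covers⁻ : ∀ {S π m} → m ∈ covers (S , π) →
              ∃ λ x → ∃ λ y → IsRep π x × IsRep π y × x Fin.< y × m ≡ merge (S , π) x y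
  ∈-covers⁻ {S} {π} m∈ with ∈-map⁻ (λ (a , b) → merge (S , π) a b) m∈
  ... | (x , y) , xy∈ , refl = let x∈ , y∈ , x<y = ∈-pairsOf⁻ (reps-sorted π) xy∈ in
    x , y , ∈-reps⁻ π x∈ , ∈-reps⁻ π y∈ , x<y , refl

  ∈-covers⁺ : ∀ {S π x y} → IsRep π x → IsRep π y → x Fin.< y → merge (S , π) x y ∈ covers (S , π)
  ∈-covers⁺ {S} {π} rx ry x<y = ∈-map⁺ (λ (a , b) → merge (S , π) a b)
    (∈-pairsOf⁺ <-irrefl <-asym (reps-sorted π) (∈-reps⁺ π rx) (∈-reps⁺ π ry) x<y)

  length-covers : ∀ e → length (covers e) ≡ #blocks e C 2
  length-covers (S , π) = trans (length-map _ (pairsOf (reps π))) (length-pairsOf (reps π))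

  covers-empty : ∀ (e : Emb n) → #blocks e ≡ 1 → ∀ {m} → ¬ m ∈ covers e
  covers-empty e one m∈ with covers e | length-covers e
  ... | []    | _ = case m∈ of λ ()
  ... | _ ∷ _ | ℓ≡ rewrite one = case ℓ≡ of λ ()

  covers-nonempty : ∀ (e : Emb n) {k} → #blocks e ≡ suc (suc k) → ∃ λ m → m ∈ covers e
  covers-nonempty e {k} two+ with covers e | length-covers e
  ... | m ∷ _ | _ = m , here refl
  ... | []    | ℓ≡ rewrite two+ | suc-C2 (suc k) = case ℓ≡ of λ ()

  module MergeReps {S π} (E : IsEmbedded (S , π)) {x y}
                   (rx : IsRep π x) (ry : IsRep π y) (x<y : x Fin.< y) where

    open Merge {S = S} {π = π} E x y public

    blocks-≢ : A ≢ B
    blocks-≢ A≡B = <-irrefl (rep-injective π rx ry A≡B) x<y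

    minOf-A∪B : minOf (A ∪ B) ≡ just x
    minOf-A∪B = minOf-unique (A ∪ B) (p⊆p∪q B (minOf-∈ A rx)) x≤
      where
      x≤ : ∀ {z} → z ∈ₛ A ∪ B → x ≤ z
      x≤ z∈ with x∈p∪q⁻ A B z∈
      ... | inj₁ z∈A = minOf-≤ A rx z∈A
      ... | inj₂ z∈B = ≤-trans (<⇒≤ x<y) (minOf-≤ B ry z∈B)

    rep-merge⁻ : ∀ {i} → IsRep πm i → IsRep π i × i ≢ y
    rep-merge⁻ {i} ri with fuse-cases A B (lookup π i)
    ... | inj₁ (_ , eq) = subst (IsRep π) x≡i rx , λ i≡y → <-irrefl (trans x≡i i≡y) x<y
      where
      x≡i = just-injective (trans (sym minOf-A∪B) (trans (cong minOf (sym (trans (lookup-merge i) eq))) ri))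
    ... | inj₂ (¬h , eq) =
      subst (λ C → minOf C ≡ just i) (trans (lookup-merge i) eq) ri , λ { refl → ¬h (inj₂ refl) }

    rep-merge⁺ : ∀ {i} → IsRep π i → i ≢ y → IsRep πm i
    rep-merge⁺ {i} ri i≢y with fuse-cases A B (lookup π i)
    ... | inj₁ (inj₁ πi≡A , eq) =
      trans (cong minOf (trans (lookup-merge i) eq))
            (trans minOf-A∪B (cong just (rep-injective π rx ri (sym πi≡A))))
    ... | inj₁ (inj₂ πi≡B , _)  = ⊥-elim (i≢y (rep-injective π ri ry πi≡B))
    ... | inj₂ (_ , eq)         = trans (cong minOf (trans (lookup-merge i) eq)) ri

    #blocks-merge : #blocks (S , π) ≡ suc (#blocks (merge (S , π) x y))
    #blocks-merge =
      length-filter-remove (isRep? π) (isRep? πm) (allFin n) (Unique.allFin⁺ n) (∈-allFin y) ry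
                           rep-merge⁻ rep-merge⁺

    -- Applied to z = x and z = y, this gives {A , B} = {π x′ , π y′}.
    oneOf-of-merge : ∀ {x′ y′} → πm ≡ Vec.map (fuse (lookup π x′) (lookup π y′)) π →
                     ∀ {z} → OneOf A B (lookup π z) → OneOf (lookup π x′) (lookup π y′) (lookup π z)
    oneOf-of-merge {x′} {y′} πm≡ {z} h with fuse-cases (lookup π x′) (lookup π y′) (lookup π z)
    ... | inj₁ (h′ , _) = h′
    ... | inj₂ (_ , eq) = ⊥-elim (blocks-≢ (trans (block-of-member x∈) (sym (block-of-member y∈))))
      where
      open PartitionProperties {π = π} P
      A∪B≡πz : A ∪ B ≡ lookup π z
      A∪B≡πz = begin
        A ∪ B                                              ≡⟨ sym (fuse-oneOf h) ⟩
        f (lookup π z)                                     ≡⟨ sym (lookup-merge z) ⟩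
        lookup πm z                                        ≡⟨ cong (λ σ → lookup σ z) πm≡ ⟩
        lookup (Vec.map (fuse (lookup π x′) (lookup π y′)) π) z ≡⟨ Vec.lookup-map z _ π ⟩
        fuse (lookup π x′) (lookup π y′) (lookup π z)      ≡⟨ eq ⟩
        lookup π z                                         ∎
      x∈ : x ∈ₛ lookup π z
      x∈ = subst (x ∈ₛ_) A∪B≡πz (p⊆p∪q B (∈-own-block x))
      y∈ : y ∈ₛ lookup π z
      y∈ = subst (y ∈ₛ_) A∪B≡πz (q⊆p∪q A B (∈-own-block y))

    merge-injective : ∀ {x′ y′} → IsRep π x′ → IsRep π y′ → x′ Fin.< y′ →
                      merge (S , π) x y ≡ merge (S , π) x′ y′ → (x , y) ≡ (x′ , y′)
    merge-injective {x′} {y′} rx′ ry′ x′<y′ m≡m′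
      with oneOf-of-merge (cong proj₂ m≡m′) (inj₁ refl) | oneOf-of-merge (cong proj₂ m≡m′) (inj₂ refl)
    ... | inj₁ πx≡πx′ | inj₂ πy≡πy′ =
      cong₂ _,_ (rep-injective π rx rx′ πx≡πx′) (rep-injective π ry ry′ πy≡πy′)
    ... | inj₁ πx≡πx′ | inj₁ πy≡πx′ = ⊥-elim (blocks-≢ (trans πx≡πx′ (sym πy≡πx′)))
    ... | inj₂ πx≡πy′ | inj₂ πy≡πy′ = ⊥-elim (blocks-≢ (trans πx≡πy′ (sym πy≡πy′)))
    ... | inj₂ πx≡πy′ | inj₁ πy≡πx′ with rep-injective π rx ry′ πx≡πy′ | rep-injective π ry rx′ πy≡πx′
    ...   | refl | refl = ⊥-elim (<-asym x<y x′<y′)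

  covers-unique : ∀ {e} → IsEmbedded e → Unique (covers e)
  covers-unique {S , π} E = map-unique _ (pairsOf-unique <-irrefl (reps-sorted π)) injective
    where
    injective : ∀ {p q} → p ∈ pairsOf (reps π) → q ∈ pairsOf (reps π) →
                merge (S , π) (proj₁ p) (proj₂ p) ≡ merge (S , π) (proj₁ q) (proj₂ q) → p ≡ q
    injective p∈ q∈ =
      let x∈ , y∈ , x<y = ∈-pairsOf⁻ (reps-sorted π) p∈
          x′∈ , y′∈ , x′<y′ = ∈-pairsOf⁻ (reps-sorted π) q∈
      in MergeReps.merge-injective {S} {π} E (∈-reps⁻ π x∈) (∈-reps⁻ π y∈) x<y
           (∈-reps⁻ π x′∈) (∈-reps⁻ π y′∈) x′<y′

  ∈-covers⇒⋖ : ∀ {e m} → IsEmbedded e → m ∈ covers e → e ⋖ m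
  ∈-covers⇒⋖ {S , π} E m∈ with ∈-covers⁻ {S} m∈
  ... | x , y , rx , ry , x<y , refl = merge-⋖ blocks-≢
    where open MergeReps {S} {π} E rx ry x<y

  ∈-covers⇒#blocks : ∀ {e m k} → IsEmbedded e → m ∈ covers e → #blocks e ≡ suc k → #blocks m ≡ k
  ∈-covers⇒#blocks {S , π} E m∈ #e with ∈-covers⁻ {S} m∈
  ... | x , y , rx , ry , x<y , refl = suc-injective (trans (sym #blocks-merge) #e)
    where open MergeReps {S} {π} E rx ry x<y

  refines-same-block : ∀ {π π′ : Partition-rep n} → IsPartition π → IsPartition π′ → Refines π π′ →
                       ∀ {i j} → lookup π i ≡ lookup π j → lookup π′ i ≡ lookup π′ j
  refines-same-block {π} {π′} P P′ π≤π′ {i} {j} πi≡πj =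
    π′.block-of-member
      (Refines⇒⊆ {π = π} {π′} P P′ π≤π′ j (subst (i ∈ₛ_) πi≡πj (π.∈-own-block i)))
    where module π = PartitionProperties {π = π} P
          module π′ = PartitionProperties {π = π′} P′

  joinable-points : ∀ {S π S′ π′} → IsEmbedded (S , π) → IsEmbedded (S′ , π′) →
                    (S , π) ⊑ (S′ , π′) → (S , π) ≢ (S′ , π′) →
                    ∃ λ i → ∃ λ k → lookup π i ≢ lookup π k × lookup π′ i ≡ lookup π′ k
  joinable-points {S} {π} {S′} {π′} E (_ , P′ , bS′) (S⊆S′ , π≤π′) e≢e′ =
    i , k , πi≢πk , sym π′k≡π′i
    where
    P = proj₁ (proj₂ E)
    module π = PartitionProperties {π = π} P
    module π′ = PartitionProperties {π = π′} P′
    π≢π′ : π ≢ π′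
    π≢π′ refl = let s , s∈ = proj₁ E in e≢e′ (π.embedded-≡ (proj₂ (proj₂ E)) bS′ s∈ (S⊆S′ s∈))
    ∃i : ∃ λ i → lookup π i ≢ lookup π′ i
    ∃i = ¬∀⟶∃¬ n _ (λ i → lookup π i ≟ₛ lookup π′ i)
           (λ πi≡π′i → π≢π′ (Pointwise-≡⇒≡ (ext πi≡π′i)))
    i = proj₁ ∃i
    ∃k : ∃ λ k → ¬ (k ∈ₛ lookup π′ i → k ∈ₛ lookup π i)
    ∃k = ¬∀⟶∃¬ n _ (λ k → k ∈? lookup π′ i →-dec k ∈? lookup π i)
           (λ π′i⊆πi → proj₂ ∃i (⊆-antisym (Refines⇒⊆ {π = π} {π′} P P′ π≤π′ i) (π′i⊆πi _)))
    k = proj₁ ∃k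
    k∈π′i : k ∈ₛ lookup π′ i
    k∈π′i = decidable-stable (k ∈? lookup π′ i) (λ k∉ → proj₂ ∃k (λ k∈ → ⊥-elim (k∉ k∈)))
    πi≢πk : lookup π i ≢ lookup π k
    πi≢πk πi≡πk = proj₂ ∃k (λ _ → subst (k ∈ₛ_) (sym πi≡πk) (π.∈-own-block k))
    π′k≡π′i : lookup π′ k ≡ lookup π′ i
    π′k≡π′i = π′.block-of-member k∈π′i

  merge-of-reps-below : ∀ {S π S′ π′} → IsEmbedded (S , π) → IsEmbedded (S′ , π′) →
                        (S , π) ⊑ (S′ , π′) → ∀ {a b} → IsRep π a → IsRep π b →
                        lookup π a ≢ lookup π b → lookup π′ a ≡ lookup π′ b →
                        ∃ λ m → m ∈ covers (S , π) × m ⊑ (S′ , π′)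
  merge-of-reps-below {S} {π} {S′} {π′} E E′ e⊑e′ {a} {b} ra rb πa≢πb π′a≡π′b with <-cmp a b
  ... | tri< a<b _ _ =
    _ , ∈-covers⁺ {S} ra rb a<b , Merge.merge-least {S = S} {π = π} E a b {S′} {π′} E′ e⊑e′ π′a≡π′b
  ... | tri> _ _ b<a =
    _ , ∈-covers⁺ {S} rb ra b<a , Merge.merge-least {S = S} {π = π} E b a {S′} {π′} E′ e⊑e′ (sym π′a≡π′b)
  ... | tri≈ _ refl _ = ⊥-elim (πa≢πb refl)

  covers-complete : ∀ {e e′} → IsEmbedded e → IsEmbedded e′ → e ⊑ e′ → e ≢ e′ →
                    ∃ λ m → m ∈ covers e × m ⊑ e′
  covers-complete {S , π} {S′ , π′} E E′ e⊑e′ e≢e′ with joinable-points E E′ e⊑e′ e≢e′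
  ... | i , k , πi≢πk , π′i≡π′k with rep-of {π} P i | rep-of {π} P k
    where P = proj₁ (proj₂ E)
  ... | a , ra , πa≡πi | b , rb , πb≡πk =
    merge-of-reps-below {S} {π} {S′} {π′} E E′ e⊑e′ ra rb
      (λ πa≡πb → πi≢πk (trans (sym πa≡πi) (trans πa≡πb πb≡πk)))
      (trans (same πa≡πi) (trans π′i≡π′k (sym (same πb≡πk))))
    where same = refines-same-block {π} {π′} (proj₁ (proj₂ E)) (proj₁ (proj₂ E′)) (proj₂ e⊑e′)

-- Saturated chains

-- The number of saturated chains up from a partition with k + 1 blocks.
chainCount : ℕ → ℕ
chainCount zero    = 1
chainCount (suc k) = (suc (suc k) C 2) * chainCount k

chainCount-closed : ∀ k → chainCount k * 2 ^ k ≡ suc k ! * k !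
chainCount-closed zero    = refl
chainCount-closed (suc k) = begin
  (suc (suc k) C 2) * chainCount k * (2 * 2 ^ k)     ≡⟨ regroup (suc (suc k) C 2) (chainCount k) (2 ^ k) ⟩
  (2 * (suc (suc k) C 2)) * (chainCount k * 2 ^ k)   ≡⟨ cong₂ _*_ (2*suc-C2 (suc k)) (chainCount-closed k) ⟩
  (suc (suc k) * suc k) * (suc k ! * k !)            ≡⟨ interchange (suc (suc k)) (suc k) (suc k !) (k !) ⟩
  (suc (suc k) * suc k !) * (suc k * k !)            ∎
  where
  regroup : ∀ a b c → a * b * (2 * c) ≡ (2 * a) * (b * c)
  regroup = solve-∀
  interchange : ∀ a b c d → (a * b) * (c * d) ≡ (a * c) * (b * d)
  interchange = solve-∀

module _ {n : ℕ} where

  saturatedChains : ℕ → Emb n → List (List (Emb n))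
  saturatedChains zero    e = (e ∷ []) ∷ []
  saturatedChains (suc k) e = concatMap (λ m → map (e ∷_) (saturatedChains k m)) (covers e)

  MaximalAbove : Emb n → List (Emb n) → Set
  MaximalAbove e rest = ∀ x → IsEmbedded x → e ⊑ x → All (λ y → x ⊑ y ⊎ y ⊑ x) rest → x ∈ e ∷ rest

  ∈-saturatedChains⁻ : ∀ k {e c} → c ∈ saturatedChains (suc k) e →
                       ∃ λ m → m ∈ covers e × ∃ λ c′ → c′ ∈ saturatedChains k m × c ≡ e ∷ c′
  ∈-saturatedChains⁻ k {e} c∈
    with ∈-concatMap⁻′ (λ m → map (e ∷_) (saturatedChains k m)) (covers e) c∈
  ... | m , m∈ , c∈′ with ∈-map⁻ (e ∷_) c∈′
  ...   | c′ , c′∈ , refl = m , m∈ , c′ , c′∈ , refl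

  ∈-saturatedChains⁺ : ∀ k {e m c′} → m ∈ covers e → c′ ∈ saturatedChains k m →
                       e ∷ c′ ∈ saturatedChains (suc k) e
  ∈-saturatedChains⁺ k {e} m∈ c′∈ =
    ∈-concatMap⁺′ (λ m → map (e ∷_) (saturatedChains k m)) m∈ (∈-map⁺ (e ∷_) c′∈)

  saturatedChains-head : ∀ k {e c} → c ∈ saturatedChains k e → ∃ λ rest → c ≡ e ∷ rest
  saturatedChains-head zero    (here refl) = [] , refl
  saturatedChains-head (suc k) c∈ with ∈-saturatedChains⁻ k c∈
  ... | _ , _ , c′ , _ , refl = c′ , refl

  length-∈-saturatedChains : ∀ k {e c} → c ∈ saturatedChains k e → length c ≡ suc k
  length-∈-saturatedChains zero    (here refl) = refl
  length-∈-saturatedChains (suc k) c∈ with ∈-saturatedChains⁻ k c∈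
  ... | _ , _ , _ , c′∈ , refl = cong suc (length-∈-saturatedChains k c′∈)

  ⊑-head⇒comparable : ∀ {x e : Emb n} {rest} → All (λ y → e ⊑ y × e ≢ y) rest → x ⊑ e →
                      All (λ y → x ⊑ y ⊎ y ⊑ x) (e ∷ rest)
  ⊑-head⇒comparable {x} {e} e<rest x⊑e =
    inj₁ x⊑e ∷ All.map (λ {y} (e⊑y , _) → inj₁ (⊑-trans {e = x} {e′ = e} {e″ = y} x⊑e e⊑y)) e<rest

  ∈-chain-below-head : ∀ {x e : Emb n} {rest} → C.IsChain n (e ∷ rest) → x ∈ e ∷ rest →
                       IsEmbedded x → x ⊑ e → x ≡ e
  ∈-chain-below-head _                       (here x≡e) _  _   = x≡e
  ∈-chain-below-head {x} {e} (Ee ∷ _ , e<rest ∷ _) (there x∈) Ex x⊑e =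
    let e⊑x , e≢x = All.lookup e<rest x∈ in ⊥-elim (e≢x (⊑-antisym {e = e} {e′ = x} Ee Ex e⊑x x⊑e))

  cons-chain : ∀ {e m rest} → IsEmbedded e → e ⊑ m → e ≢ m → C.IsChain n (m ∷ rest) →
               C.IsChain n (e ∷ m ∷ rest)
  cons-chain {e} {m} Ee e⊑m e≢m (Em ∷ Es , m<rest ∷ ap) =
    Ee ∷ Em ∷ Es , ((e⊑m , e≢m) ∷ All.map e<y m<rest) ∷ m<rest ∷ ap
    where
    e<y : ∀ {y} → m ⊑ y × m ≢ y → e ⊑ y × e ≢ y
    e<y {y} (m⊑y , _) =
      ⊑-trans {e = e} {e′ = m} {e″ = y} e⊑m m⊑y ,
      λ { refl → e≢m (⊑-antisym {e = e} {e′ = m} Ee Em e⊑m m⊑y) }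

  ⋖-cons-maximal : ∀ {e m rest} → e ⋖ m → MaximalAbove m rest → MaximalAbove e (m ∷ rest)
  ⋖-cons-maximal e⋖m max x Ex e⊑x (inj₁ x⊑m ∷ _) with _⋖_.tight e⋖m Ex e⊑x x⊑m
  ... | inj₁ x≡e = here x≡e
  ... | inj₂ x≡m = there (here x≡m)
  ⋖-cons-maximal e⋖m max x Ex e⊑x (inj₂ m⊑x ∷ comparable) = there (max x Ex m⊑x comparable)

  MaximalAbove-tail : ∀ {e e′ rest} → C.IsChain n (e ∷ e′ ∷ rest) → MaximalAbove e (e′ ∷ rest) →
                      MaximalAbove e′ rest
  MaximalAbove-tail {e} {e′} (Ee ∷ Ee′ ∷ _ , ((e⊑e′ , e≢e′) ∷ _) ∷ _) max x Ex e′⊑x comparable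
    with max x Ex (⊑-trans {e = e} {e′ = e′} {e″ = x} e⊑e′ e′⊑x) (inj₂ e′⊑x ∷ comparable)
  ... | here refl = ⊥-elim (e≢e′ (⊑-antisym {e = e} {e′ = e′} Ee Ee′ e⊑e′ e′⊑x))
  ... | there x∈ = x∈

  maximal-next-⋖ : ∀ {e e′ m rest} → C.IsChain n (e ∷ e′ ∷ rest) → MaximalAbove e (e′ ∷ rest) →
                   e ⋖ m → m ⊑ e′ → m ≡ e′
  maximal-next-⋖ {e′ = e′} {m} (_ ∷ Es , _ ∷ ap) max e⋖m m⊑e′
    with max m (_⋖_.embedded e⋖m) (_⋖_.below e⋖m)
             (⊑-head⇒comparable {x = m} {e = e′} (AllPairs.head ap) m⊑e′)
  ... | here m≡e = ⊥-elim (_⋖_.distinct e⋖m (sym m≡e))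
  ... | there m∈ = ∈-chain-below-head (Es , ap) m∈ (_⋖_.embedded e⋖m) m⊑e′

  saturatedChains-sound : ∀ k {e} → IsEmbedded e → #blocks e ≡ suc k →
                          ∀ {rest} → e ∷ rest ∈ saturatedChains k e →
                          C.IsChain n (e ∷ rest) × MaximalAbove e rest
  saturatedChains-sound zero {e} Ee one (here refl) = (Ee ∷ [] , [] ∷ []) , maximal
    where
    maximal : MaximalAbove e []
    maximal x Ex e⊑x _ with x ≟ₑ e
    ... | yes x≡e = here x≡e
    ... | no x≢e  = let m , m∈ , _ = covers-complete Ee Ex e⊑x (λ e≡x → x≢e (sym e≡x)) in
                    ⊥-elim (covers-empty e one m∈)
  saturatedChains-sound (suc k) {e} Ee #e c∈ with ∈-saturatedChains⁻ k c∈
  ... | m , m∈ , c′ , c′∈ , refl with saturatedChains-head k c′∈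
  ...   | rest , refl =
    let e⋖m = ∈-covers⇒⋖ Ee m∈
        chain , maximal = saturatedChains-sound k (_⋖_.embedded e⋖m) (∈-covers⇒#blocks Ee m∈ #e) c′∈
    in cons-chain Ee (_⋖_.below e⋖m) (_⋖_.distinct e⋖m) chain , ⋖-cons-maximal e⋖m maximal

  saturatedChains-complete : ∀ k {e} → IsEmbedded e → #blocks e ≡ suc k → ∀ {rest} →
                             C.IsChain n (e ∷ rest) → MaximalAbove e rest → e ∷ rest ∈ saturatedChains k e
  saturatedChains-complete zero    _  _  {[]} _ _ = here refl
  saturatedChains-complete (suc k) {e} Ee #e {[]} _ max =
    ⊥-elim (not-maximal (proj₂ (covers-nonempty e #e)))
    where
    not-maximal : ∀ {m} → m ∈ covers e → ⊥
    not-maximal {m} m∈ = case max m embedded below [] of λ { (here m≡e) → distinct (sym m≡e) }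
      where open _⋖_ (∈-covers⇒⋖ Ee m∈)
  saturatedChains-complete zero {e} Ee one {e′ ∷ _} (_ ∷ Ee′ ∷ _ , ((e⊑e′ , e≢e′) ∷ _) ∷ _) _ =
    ⊥-elim (covers-empty e one (proj₁ (proj₂ (covers-complete Ee Ee′ e⊑e′ e≢e′))))
  saturatedChains-complete (suc k) {e} Ee #e {e′ ∷ rest}
                           chain@(_ ∷ Ee′ ∷ Es , ((e⊑e′ , e≢e′) ∷ _) ∷ ap) max
    with covers-complete Ee Ee′ e⊑e′ e≢e′
  ... | m , m∈ , m⊑e′ with maximal-next-⋖ chain max (∈-covers⇒⋖ Ee m∈) m⊑e′
  ...   | refl = ∈-saturatedChains⁺ k m∈
                   (saturatedChains-complete k Ee′ (∈-covers⇒#blocks Ee m∈ #e) (Ee′ ∷ Es , ap)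
                     (MaximalAbove-tail chain max))

  saturatedChains-unique : ∀ k {e} → IsEmbedded e → Unique (saturatedChains k e)
  saturatedChains-unique zero    _ = [] ∷ []
  saturatedChains-unique (suc k) {e} Ee =
    concatMap-unique (λ m → map (e ∷_) (saturatedChains k m)) (head ∘ drop 1) (covers-unique Ee)
      (λ m∈ → Unique.map⁺ ∷-injectiveʳ (saturatedChains-unique k (_⋖_.embedded (∈-covers⇒⋖ Ee m∈))))
      second
    where
    second : ∀ {m c} → m ∈ covers e → c ∈ map (e ∷_) (saturatedChains k m) → head (drop 1 c) ≡ just m
    second m∈ c∈ with ∈-map⁻ (e ∷_) c∈
    ... | c′ , c′∈ , refl with saturatedChains-head k c′∈
    ...   | _ , refl = refl

  length-saturatedChains : ∀ k {e} → IsEmbedded e → #blocks e ≡ suc k →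
                           length (saturatedChains k e) ≡ chainCount k
  length-saturatedChains zero    _ _ = refl
  length-saturatedChains (suc k) {e} Ee #e =
    trans (length-concatMap-const (λ m → map (e ∷_) (saturatedChains k m)) (covers e) (chainCount k) each)
          (cong (_* chainCount k) (trans (length-covers e) (cong (_C 2) #e)))
    where
    each : ∀ {m} → m ∈ covers e → length (map (e ∷_) (saturatedChains k m)) ≡ chainCount k
    each {m} m∈ = trans (length-map (e ∷_) (saturatedChains k m))
      (length-saturatedChains k (_⋖_.embedded (∈-covers⇒⋖ Ee m∈)) (∈-covers⇒#blocks Ee m∈ #e))

-- Maximal chains of C(n) and of C(n)_⊥

module _ {n : ℕ} where

  atom : Fin n → Emb n
  atom i = ⁅ i ⁆ , tabulate ⁅_⁆

  private
    lookup-singletons : ∀ j → lookup (tabulate {n = n} ⁅_⁆) j ≡ ⁅ j ⁆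
    lookup-singletons = Vec.lookup∘tabulate ⁅_⁆

  atom-embedded : ∀ i → IsEmbedded (atom i)
  atom-embedded i = (i , x∈⁅x⁆ i) , (own , same) , (i , lookup-singletons i)
    where
    own : ∀ j → j ∈ₛ lookup (tabulate ⁅_⁆) j
    own j = subst (j ∈ₛ_) (sym (lookup-singletons j)) (x∈⁅x⁆ j)
    same : ∀ j k → k ∈ₛ lookup (tabulate ⁅_⁆) j → lookup (tabulate ⁅_⁆) k ≡ lookup (tabulate ⁅_⁆) j
    same j k k∈ with x∈⁅y⁆⇒x≡y j (subst (k ∈ₛ_) (lookup-singletons j) k∈)
    ... | refl = refl

  atom-⊑ : ∀ {i e} → IsEmbedded e → i ∈ₛ proj₁ e → atom i ⊑ e
  atom-⊑ {i} {T , ρ} (_ , R , _) i∈T =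
    (λ z∈ → subst (_∈ₛ T) (sym (x∈⁅y⁆⇒x≡y i z∈)) i∈T) ,
    λ j → j , λ z∈ →
      subst (_∈ₛ lookup ρ j) (sym (x∈⁅y⁆⇒x≡y j (subst (_ ∈ₛ_) (lookup-singletons j) z∈))) (proj₁ R j)

  ⊑-atom⇒atom-⊑ : ∀ {i e} → IsEmbedded e → e ⊑ atom i → atom i ⊑ e
  ⊑-atom⇒atom-⊑ {i} {T , ρ} Ee@((t , t∈T) , _) (T⊆ , _) =
    atom-⊑ {i = i} {e = T , ρ} Ee (subst (_∈ₛ T) (x∈⁅y⁆⇒x≡y i (T⊆ t∈T)) t∈T)

  #blocks-atom : ∀ i → #blocks (atom i) ≡ n
  #blocks-atom i =
    trans (cong length (filter-all (isRep? (tabulate ⁅_⁆)) {xs = allFin n} (All.tabulate λ _ → singleton-rep _)))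
          (length-tabulate id)
    where
    singleton-rep : ∀ j → IsRep (tabulate ⁅_⁆) j
    singleton-rep j = trans (cong minOf (lookup-singletons j))
      (minOf-unique ⁅ j ⁆ (x∈⁅x⁆ j) (λ z∈ → ≤-reflexive (sym (x∈⁅y⁆⇒x≡y j z∈))))

  atom-injective : ∀ {i j} → atom i ≡ atom j → i ≡ j
  atom-injective {i} {j} eq = x∈⁅y⁆⇒x≡y j (subst (i ∈ₛ_) (cong proj₁ eq) (x∈⁅x⁆ i))

  adjoin⊥ : List (Emb n) → List (Maybe (Emb n))
  adjoin⊥ c = nothing ∷ map just c

  adjoin⊥-maximal : ∀ {c} → C.IsMaximalChain n c → C⊥.IsMaximalChain n (adjoin⊥ c)
  adjoin⊥-maximal {c} ((Es , ap) , maximal) =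
    (tt ∷ All.map⁺ Es , All.map⁺ (All.tabulate λ _ → tt , λ ()) ∷ AllPairs.map⁺ (AllPairs.map lift< ap)) ,
    maximal⊥
    where
    lift< : ∀ {x y} → x ⊑ y × x ≢ y → x ⊑ y × just x ≢ just y
    lift< (x⊑y , x≢y) = x⊑y , λ jx≡jy → x≢y (just-injective jx≡jy)
    maximal⊥ : ∀ x → Valid⊥ x → All (λ y → x ⊑⊥ y ⊎ y ⊑⊥ x) (adjoin⊥ c) → x ∈ adjoin⊥ c
    maximal⊥ nothing  _  _                = here refl
    maximal⊥ (just x) Ex (_ ∷ comparable) = there (∈-map⁺ just (maximal x Ex (All.map⁻ comparable)))

  maximal⊥⇒adjoin⊥ : ∀ {d} → C⊥.IsMaximalChain n d → nothing ∈ d →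
                     ∃ λ c → d ≡ adjoin⊥ c × C.IsMaximalChain n c
  maximal⊥⇒adjoin⊥ {just y ∷ _} ((_ , y<rest ∷ _) , _) (there ⊥∈) = ⊥-elim (proj₁ (All.lookup y<rest ⊥∈))
  maximal⊥⇒adjoin⊥ {nothing ∷ ys} ((_ ∷ Es , ⊥<ys ∷ ap) , maximal) _ with all-just ys (All.map proj₂ ⊥<ys)
    where
    all-just : ∀ ys → All (nothing ≢_) ys → ∃ λ c → ys ≡ map just c
    all-just []             _           = [] , refl
    all-just (nothing ∷ _)  (⊥≢⊥ ∷ _)   = ⊥-elim (⊥≢⊥ refl)
    all-just (just y ∷ ys)  (_ ∷ ⊥≢ys) = let c , ys≡ = all-just ys ⊥≢ys in y ∷ c , cong (just y ∷_) ys≡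
  ... | c , refl = c , refl , (All.map⁻ Es , AllPairs.map unlift< (AllPairs.map⁻ ap)) , maximal′
    where
    unlift< : ∀ {x y} → x ⊑ y × just x ≢ just y → x ⊑ y × x ≢ y
    unlift< (x⊑y , jx≢jy) = x⊑y , λ x≡y → jx≢jy (cong just x≡y)
    maximal′ : ∀ x → IsEmbedded x → All (λ y → x ⊑ y ⊎ y ⊑ x) c → x ∈ c
    maximal′ x Ex comparable with maximal (just x) Ex (inj₂ tt ∷ All.map⁺ comparable)
    ... | there jx∈ with ∈-map⁻ just jx∈
    ...   | y , y∈ , refl = y∈

module MaximalChains (k : ℕ) where

  private
    n = suc k

  top-embedded : IsEmbedded (topEmb n)
  top-embedded = (zero , ∈⊤) , (own , same) , (zero , Vec.lookup-replicate {n = n} zero ⊤ₛ)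
    where
    own : ∀ i → i ∈ₛ lookup (replicate n ⊤ₛ) i
    own i = subst (i ∈ₛ_) (sym (Vec.lookup-replicate i ⊤ₛ)) ∈⊤
    same : ∀ i j → j ∈ₛ lookup (replicate n ⊤ₛ) i →
           lookup (replicate n ⊤ₛ) j ≡ lookup (replicate n ⊤ₛ) i
    same i j _ = trans (Vec.lookup-replicate j ⊤ₛ) (sym (Vec.lookup-replicate i ⊤ₛ))

  ⊑-top : ∀ e → e ⊑ topEmb n
  ⊑-top e = (λ _ → ∈⊤) , λ i → i , λ _ → subst (_ ∈ₛ_) (sym (Vec.lookup-replicate i ⊤ₛ)) ∈⊤

  maximalChains : List (List (Emb n))
  maximalChains = concatMap (saturatedChains k) (map atom (allFin n))

  ∈-maximalChains⇒maximal : ∀ {c} → c ∈ maximalChains → C.IsMaximalChain n c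
  ∈-maximalChains⇒maximal c∈ with ∈-concatMap⁻′ (saturatedChains k) (map atom (allFin n)) c∈
  ... | a , a∈ , c∈′ with ∈-map⁻ atom {xs = allFin n} a∈
  ...   | i , _ , refl with saturatedChains-head k c∈′
  ...     | rest , refl = chain , maximal
    where
    chain-max = saturatedChains-sound k (atom-embedded i) (#blocks-atom i) c∈′
    chain = proj₁ chain-max
    maximal : ∀ x → IsEmbedded x → All (λ y → x ⊑ y ⊎ y ⊑ x) (atom i ∷ rest) → x ∈ atom i ∷ rest
    maximal x Ex (inj₂ a⊑x ∷ comparable) = proj₂ chain-max x Ex a⊑x comparable
    maximal x Ex (inj₁ x⊑a ∷ comparable) =
      proj₂ chain-max x Ex (⊑-atom⇒atom-⊑ {i = i} {e = x} Ex x⊑a) comparable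

  -- The chain contains the atom below any point of its least element e, so it starts at that atom.
  maximal⇒∈-maximalChains : ∀ {c} → C.IsMaximalChain n c → c ∈ maximalChains
  maximal⇒∈-maximalChains {[]} (_ , maximal) = case maximal (atom zero) (atom-embedded zero) [] of λ ()
  maximal⇒∈-maximalChains {e ∷ rest} chain@((Ee ∷ _ , e<rest ∷ _) , maximal) =
    ∈-concatMap⁺′ (saturatedChains k) (subst (_∈ map atom (allFin n)) a≡e (∈-map⁺ atom (∈-allFin s)))
      (saturatedChains-complete k Ee (subst (λ x → #blocks x ≡ n) a≡e (#blocks-atom s)) (proj₁ chain)
        (λ x Ex e⊑x comparable → maximal x Ex (inj₂ e⊑x ∷ comparable)))
    where
    s = proj₁ (proj₁ Ee)
    a⊑e : atom s ⊑ e
    a⊑e = atom-⊑ {i = s} {e = e} Ee (proj₂ (proj₁ Ee))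
    a≡e : atom s ≡ e
    a≡e = ∈-chain-below-head {x = atom s} {e = e} (proj₁ chain)
            (maximal (atom s) (atom-embedded s) (⊑-head⇒comparable {x = atom s} {e = e} e<rest a⊑e))
            (atom-embedded s) a⊑e

  length-∈-maximalChains : ∀ {c} → c ∈ maximalChains → length c ≡ n
  length-∈-maximalChains c∈ with ∈-concatMap⁻′ (saturatedChains k) (map atom (allFin n)) c∈
  ... | _ , _ , c∈′ = length-∈-saturatedChains k c∈′

  maximalChains-unique : Unique maximalChains
  maximalChains-unique =
    concatMap-unique (saturatedChains k) head (Unique.map⁺ atom-injective (Unique.allFin⁺ n)) each starts-at
    where
    each : ∀ {a} → a ∈ map atom (allFin n) → Unique (saturatedChains k a)
    each a∈ with ∈-map⁻ atom {xs = allFin n} a∈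
    ... | i , _ , refl = saturatedChains-unique k (atom-embedded i)
    starts-at : ∀ {a c} → a ∈ map atom (allFin n) → c ∈ saturatedChains k a → head c ≡ just a
    starts-at _ c∈ with saturatedChains-head k c∈
    ... | _ , refl = refl

  length-maximalChains : length maximalChains ≡ n * chainCount k
  length-maximalChains =
    trans (length-concatMap-const (saturatedChains k) (map atom (allFin n)) (chainCount k) each)
          (cong (_* chainCount k) (trans (length-map atom (allFin n)) (length-tabulate {n = n} id)))
    where
    each : ∀ {a} → a ∈ map atom (allFin n) → length (saturatedChains k a) ≡ chainCount k
    each a∈ with ∈-map⁻ atom {xs = allFin n} a∈
    ... | i , _ , refl = length-saturatedChains k (atom-embedded i) (#blocks-atom i)

  -- All maximal chains have n elements, so each of them has greatest length.
  numberOf-longest : NumberOf (C.IsLongestMaximalChain n) (n * chainCount k)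
  numberOf-longest = maximalChains , maximalChains-unique , (λ _ → mk⇔ longest maximal) , length-maximalChains
    where
    longest : ∀ {c} → c ∈ maximalChains → C.IsLongestMaximalChain n c
    longest c∈ = ∈-maximalChains⇒maximal c∈ , λ d d-max → ℕ.≤-reflexive
      (trans (length-∈-maximalChains (maximal⇒∈-maximalChains d-max)) (sym (length-∈-maximalChains c∈)))
    maximal : ∀ {c} → C.IsLongestMaximalChain n c → c ∈ maximalChains
    maximal (c-max , _) = maximal⇒∈-maximalChains c-max

  numberOf-⊥-to-top : NumberOf (IsMaxChain⊥toTop n) (n * chainCount k)
  numberOf-⊥-to-top =
    map adjoin⊥ maximalChains , Unique.map⁺ adjoin⊥-injective maximalChains-unique , (λ _ → mk⇔ to from) ,
    trans (length-map adjoin⊥ maximalChains) length-maximalChains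
    where
    adjoin⊥-injective : ∀ {c c′} → adjoin⊥ c ≡ adjoin⊥ c′ → c ≡ c′
    adjoin⊥-injective eq = map-injective just-injective (∷-injectiveʳ eq)
    top∈ : ∀ {c} → C.IsMaximalChain n c → topEmb n ∈ c
    top∈ ((Es , _) , maximal) = maximal (topEmb n) top-embedded (All.map (λ {y} _ → inj₂ (⊑-top y)) Es)
    to : ∀ {d} → d ∈ map adjoin⊥ maximalChains → IsMaxChain⊥toTop n d
    to d∈ with ∈-map⁻ adjoin⊥ d∈
    ... | c , c∈ , refl = let c-max = ∈-maximalChains⇒maximal c∈ in
      adjoin⊥-maximal c-max , here refl , there (∈-map⁺ just (top∈ c-max))
    from : ∀ {d} → IsMaxChain⊥toTop n d → d ∈ map adjoin⊥ maximalChains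
    from (d-max , ⊥∈ , _) with maximal⊥⇒adjoin⊥ d-max ⊥∈
    ... | c , refl , c-max = ∈-map⁺ adjoin⊥ (maximal⇒∈-maximalChains c-max)

formula-suc : ∀ k → formula (suc k) ≡ suc k * chainCount k
formula-suc k = begin
  formula (suc k)
    ≡⟨ cong (λ z → (z / 2 ^ k) {{m^n≢0 2 k}}) square ⟩
  (suc k * chainCount k * 2 ^ k / 2 ^ k) {{m^n≢0 2 k}}
    ≡⟨ m*n/n≡m (suc k * chainCount k) (2 ^ k) {{m^n≢0 2 k}} ⟩
  suc k * chainCount k
    ∎
  where
  square : suc k ! * suc k ! ≡ suc k * chainCount k * 2 ^ k
  square = begin
    suc k ! * (suc k * k !)           ≡⟨ swap (suc k !) (suc k) (k !) ⟩
    suc k * (suc k ! * k !)           ≡⟨ cong (suc k *_) (sym (chainCount-closed k)) ⟩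
    suc k * (chainCount k * 2 ^ k)    ≡⟨ sym (*-assoc (suc k) (chainCount k) (2 ^ k)) ⟩
    suc k * chainCount k * 2 ^ k      ∎
    where
    swap : ∀ a b c → a * (b * c) ≡ b * (a * c)
    swap = solve-∀

proposition2 : (n : ℕ) → 2 < n →
    NumberOf (IsMaxChain⊥toTop n) (formula n) ×
    NumberOf (C.IsLongestMaximalChain n) (formula n)
proposition2 (suc k) _ rewrite formula-suc k = numberOf-⊥-to-top , numberOf-longest
  where open MaximalChains k
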